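{- Let $m,n\ge1$ and let $F\subset\{1,\dots,m\}\times\{1,\dots,n\}$ be a binary image with row sums $r_i=\#\{j:(i,j)\in F\}$ ($i=1,\dots,m$) and column sums $c_j=\#\{i:(i,j)\in F\}$ ($j=1,\dots,n$). Let $L_h(F)$ be the length of the horizontal boundary of $F$. Define $b_i=\#\{j: c_j\ge i\}$ and $d_i=b_i-r_i$ for $i=1,\dots,m$, and set $d_0=d_{m+1}=0$. Let $k$ be an integer with $1\le k\le m$ such that $d_k<0$ and $d_{k+1}\ge0$, and let $\sigma=\sum_{i=1}^k d_i$. Then for all integers $t,s\ge0$, all indices $i_1<\dots<i_{2t+1}$ belonging to $\{0,1,\dots,k,m+1\}$ and all indices $\tilde i_1<\dots<\tilde i_{2s+1}$ belonging to $\{0,k+1,k+2,\dots,m+1\}$, we have \[ L_h(F)\ge 2r_1 + d_{i_1}-d_{i_2}+d_{i_3}-\cdots-d_{i_{2t}}+2d_{i_{2t+1}} + d_{\tilde i_1}-d_{\tilde i_2}+d_{\tilde i_3}-\cdots-d_{\tilde i_{2s}}+2d_{\tilde i_{2s+1}}-\sigma. \]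
   Context: A binary image is a finite set $F\subset\mathbb{Z}^2$; row $i$ is $\{(x,y):x=i\}$ and column $j$ is $\{(x,y):y=j\}$. The horizontal boundary of $F$ is the set of ordered pairs of points $((i,j),(i',j))$ with $|i-i'|=1$, $(i,j)\in F$ and $(i',j)\notin F$ (points outside the $m\times n$ rectangle count as not in $F$); its length is the number of such pairs. -}

module Defs where

open import Data.Bool using (Bool; true; false; _∧_; not; if_then_else_)
open import Data.Nat using (ℕ; zero; suc; _+_; _*_; _∸_; _≤_; _<_; _<?_; _≤ᵇ_)
open import Data.Fin using (Fin; fromℕ<)
open import Data.Integer as ℤ using (ℤ; +_)
open import Data.Vec using (Vec; []; _∷_)
open import Relation.Nullary using (yes; no)

-- A binary image inside the m × n rectangle {1..m} × {1..n}:
-- F i j = true means (toℕ i + 1 , toℕ j + 1) ∈ F.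
Image : ℕ → ℕ → Set
Image m n = Fin m → Fin n → Bool

-- Membership of the lattice point (i , j) (1-indexed naturals) in F;
-- points outside {1..m} × {1..n} (e.g. row 0 or row m+1) are not in F.
mem : ∀ {m n} → Image m n → ℕ → ℕ → Bool
mem {m} {n} F zero    _       = false
mem {m} {n} F (suc i) zero    = false
mem {m} {n} F (suc i) (suc j) with i <? m | j <? n
... | yes p | yes q = F (fromℕ< p) (fromℕ< q)
... | _     | _     = false

sumTo : ℕ → (ℕ → ℕ) → ℕ
sumTo zero    f = 0
sumTo (suc n) f = sumTo n f + f (suc n)

sumToℤ : ℕ → (ℕ → ℤ) → ℤ
sumToℤ zero    f = + 0
sumToℤ (suc n) f = sumToℤ n f ℤ.+ f (suc n)

ind : Bool → ℕ
ind true  = 1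
ind false = 0

rowSum : ∀ {m n} → Image m n → ℕ → ℕ
rowSum {m} {n} F i = sumTo n (λ j → ind (mem F i j))

colSum : ∀ {m n} → Image m n → ℕ → ℕ
colSum {m} {n} F j = sumTo m (λ i → ind (mem F i j))

bSeq : ∀ {m n} → Image m n → ℕ → ℕ
bSeq {m} {n} F i = sumTo n (λ j → ind (i ≤ᵇ colSum F j))

dSeq : ∀ {m n} → Image m n → ℕ → ℤ
dSeq {m} {n} F zero = + 0
dSeq {m} {n} F (suc i) with suc i ≤ᵇ m
... | true  = + bSeq F (suc i) ℤ.- + rowSum F (suc i)
... | false = + 0

-- length of the horizontal boundary: the number of ordered pairs
-- ((i,j),(i',j)) with |i - i'| = 1, (i,j) ∈ F, (i',j) ∉ F.
-- For (i,j) ∈ F we have 1 ≤ i ≤ m, so i' ∈ {i-1, i+1} = {i ∸ 1, suc i}.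
horizBoundary : ∀ {m n} → Image m n → ℕ
horizBoundary {m} {n} F =
  sumTo n (λ j → sumTo m (λ i →
    ind (mem F i j ∧ not (mem F (suc i) j)) + ind (mem F i j ∧ not (mem F (i ∸ 1) j))))

sigma : ∀ {m n} → Image m n → ℕ → ℤ
sigma F k = sumToℤ k (dSeq F)

altSum : ∀ {m n} → Image m n → (t : ℕ) → Vec ℕ (suc (t * 2)) → ℤ
altSum F zero    (x ∷ [])         = + 2 ℤ.* dSeq F x
altSum F (suc t) (x ∷ y ∷ rest)   = dSeq F x ℤ.- dSeq F y ℤ.+ altSum F t rest

module Submission where

-- Everything in the bound is a sum over columns, so it suffices to prove it for one column j,
-- with d_i replaced by δ_i = [i ≤ c_j] − [(i, j) ∈ F].  The partial sums P_i = δ_1 + ⋯ + δ_i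
-- are nonnegative, and σ contributes P_k.  Scan the column upwards.  At each row the state is
-- finite: whether the pixel is in F, whether i ≤ c_j, whether P_i > 0, and how far the
-- alternating sum has progressed (next sign +, next sign −, finished).  An explicit potential
-- on these states shows that the boundary crossed so far always pays for the alternating
-- terms collected so far; all local inequalities are finitely many and checked by evaluation.
-- The scan is cut at row k: below it the crossings and P_k pay for 2 r₁ and the I-terms, above
-- it the crossings pay for the J-terms.  A final I-term at index k cannot be paid for inside a
-- column, but summed over all columns it is 2 d_k < 0, so it can be dropped.

open import Defs
open import Data.Bool using (Bool; true; false; T; not; _∧_; _∨_; _xor_; if_then_else_)
open import Data.Empty using (⊥-elim)
open import Data.Nat as ℕ using (ℕ; zero; suc; _+_; _*_; _∸_; _⊓_; _≤_; _<_; _≤ᵇ_; _≡ᵇ_; z≤n; s≤s)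
import Data.Nat.Properties as ℕP
open import Data.Integer as ℤ using (ℤ; +_; -[1+_]; +[1+_])
import Data.Integer.Properties as ℤP
open import Data.Integer.Tactic.RingSolver using (solve-∀)
open import Data.Nat.Tactic.RingSolver using () renaming (solve-∀ to ℕ-solve-∀)
open import Data.Fin using (Fin)
open import Data.Vec using (Vec; []; _∷_; head; last; init; lookup)
open import Data.Vec.Relation.Unary.All as All using (All; []; _∷_)
open import Data.Vec.Relation.Unary.All.Properties using (lookup⁻)
open import Data.Vec.Relation.Unary.Linked using (Linked; []; [-]; _∷_)
open import Data.Sum using (_⊎_; inj₁; inj₂)
open import Data.Product using (_×_; _,_)
open import Relation.Nullary using (Dec; yes; no)
open import Relation.Nullary.Decidable using (True; toWitness; T?; _→-dec_)
open import Relation.Binary.PropositionalEquality using (_≡_; _≢_; refl; sym; trans; cong; cong₂; subst)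

open ℤP.≤-Reasoning

≤ᵇ-true : ∀ {a b} → a ≤ b → (a ≤ᵇ b) ≡ true
≤ᵇ-true {a} {b} a≤b with a ≤ᵇ b | ℕP.≤⇒≤ᵇ a≤b
... | true | _ = refl

≤ᵇ-false : ∀ {a b} → b < a → (a ≤ᵇ b) ≡ false
≤ᵇ-false {a} {b} b<a with a ≤ᵇ b in eq
... | false = refl
... | true  = ⊥-elim (ℕP.<⇒≱ b<a (ℕP.≤ᵇ⇒≤ a b (subst T (sym eq) _)))

≡ᵇ-true : ∀ {a b} → a ≡ b → (a ≡ᵇ b) ≡ true
≡ᵇ-true {a} refl with a ≡ᵇ a | ℕP.≡⇒≡ᵇ a a refl
... | true | _ = refl

≡ᵇ-false : ∀ {a b} → a ≢ b → (a ≡ᵇ b) ≡ false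
≡ᵇ-false {a} {b} a≢b with a ≡ᵇ b in eq
... | false = refl
... | true  = ⊥-elim (a≢b (ℕP.≡ᵇ⇒≡ a b (subst T (sym eq) _)))

sumTo-cong : ∀ n {f g : ℕ → ℕ} → (∀ i → f (suc i) ≡ g (suc i)) → sumTo n f ≡ sumTo n g
sumTo-cong zero    f≗g = refl
sumTo-cong (suc n) f≗g = cong₂ _+_ (sumTo-cong n f≗g) (f≗g n)

sumTo-+ : ∀ n (f g : ℕ → ℕ) → sumTo n (λ i → f i + g i) ≡ sumTo n f + sumTo n g
sumTo-+ zero    f g = refl
sumTo-+ (suc n) f g rewrite sumTo-+ n f g = interchange (sumTo n f) (sumTo n g) (f (suc n)) (g (suc n))
  where
  interchange : ∀ a b c d → a + b + (c + d) ≡ a + c + (b + d)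
  interchange = ℕ-solve-∀

sumTo-unfoldˡ : ∀ n (f : ℕ → ℕ) → sumTo (suc n) f ≡ f 1 + sumTo n (λ i → f (suc i))
sumTo-unfoldˡ zero    f = ℕP.+-comm 0 (f 1)
sumTo-unfoldˡ (suc n) f = trans (cong (_+ f (suc (suc n))) (sumTo-unfoldˡ n f))
                                (ℕP.+-assoc (f 1) (sumTo n (λ i → f (suc i))) (f (suc (suc n))))

sumTo-ind≤ : ∀ n (b : ℕ → Bool) → sumTo n (λ i → ind (b i)) ≤ n
sumTo-ind≤ zero    b = z≤n
sumTo-ind≤ (suc n) b =
  ℕP.≤-trans (ℕP.+-mono-≤ (sumTo-ind≤ n b) (ind≤1 (b (suc n)))) (ℕP.≤-reflexive (ℕP.+-comm n 1))
  where
  ind≤1 : ∀ x → ind x ≤ 1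
  ind≤1 true  = ℕP.≤-refl
  ind≤1 false = z≤n

sumTo-monoʳ : ∀ (f : ℕ → ℕ) {n n'} → n ≤ n' → sumTo n f ≤ sumTo n' f
sumTo-monoʳ f {n} {zero}   z≤n = ℕP.≤-refl
sumTo-monoʳ f {n} {suc n'} n≤n' with ℕP.m≤n⇒m<n∨m≡n n≤n'
... | inj₁ (s≤s n≤n'') = ℕP.≤-trans (sumTo-monoʳ f n≤n'') (ℕP.m≤m+n _ _)
... | inj₂ refl        = ℕP.≤-refl

sumToℤ-cong : ∀ n {f g : ℕ → ℤ} → (∀ i → f (suc i) ≡ g (suc i)) → sumToℤ n f ≡ sumToℤ n g
sumToℤ-cong zero    f≗g = refl
sumToℤ-cong (suc n) f≗g = cong₂ ℤ._+_ (sumToℤ-cong n f≗g) (f≗g n)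

sumToℤ-zero : ∀ n → sumToℤ n (λ _ → + 0) ≡ + 0
sumToℤ-zero zero    = refl
sumToℤ-zero (suc n) = trans (ℤP.+-identityʳ _) (sumToℤ-zero n)

sumToℤ-+ : ∀ n (f g : ℕ → ℤ) → sumToℤ n (λ i → f i ℤ.+ g i) ≡ sumToℤ n f ℤ.+ sumToℤ n g
sumToℤ-+ zero    f g = refl
sumToℤ-+ (suc n) f g rewrite sumToℤ-+ n f g = interchange (sumToℤ n f) (sumToℤ n g) (f (suc n)) (g (suc n))
  where
  interchange : ∀ a b c d → a ℤ.+ b ℤ.+ (c ℤ.+ d) ≡ a ℤ.+ c ℤ.+ (b ℤ.+ d)
  interchange = solve-∀

sumToℤ-- : ∀ n (f g : ℕ → ℤ) → sumToℤ n (λ i → f i ℤ.- g i) ≡ sumToℤ n f ℤ.- sumToℤ n g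
sumToℤ-- zero    f g = refl
sumToℤ-- (suc n) f g rewrite sumToℤ-- n f g = interchange (sumToℤ n f) (sumToℤ n g) (f (suc n)) (g (suc n))
  where
  interchange : ∀ a b c d → a ℤ.- b ℤ.+ (c ℤ.- d) ≡ a ℤ.+ c ℤ.- (b ℤ.+ d)
  interchange = solve-∀

sumToℤ-*ˡ : ∀ n c (f : ℕ → ℤ) → sumToℤ n (λ i → c ℤ.* f i) ≡ c ℤ.* sumToℤ n f
sumToℤ-*ˡ zero    c f = sym (ℤP.*-zeroʳ c)
sumToℤ-*ˡ (suc n) c f rewrite sumToℤ-*ˡ n c f = sym (ℤP.*-distribˡ-+ c (sumToℤ n f) (f (suc n)))

sumToℤ-linear : ∀ n (a b c d e : ℕ → ℤ) →
  sumToℤ n (λ j → a j ℤ.+ b j ℤ.+ c j ℤ.- d j ℤ.- e j) ≡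
  sumToℤ n a ℤ.+ sumToℤ n b ℤ.+ sumToℤ n c ℤ.- sumToℤ n d ℤ.- sumToℤ n e
sumToℤ-linear zero    a b c d e = refl
sumToℤ-linear (suc n) a b c d e rewrite sumToℤ-linear n a b c d e =
  regroup (sumToℤ n a) (sumToℤ n b) (sumToℤ n c) (sumToℤ n d) (sumToℤ n e)
          (a (suc n)) (b (suc n)) (c (suc n)) (d (suc n)) (e (suc n))
  where
  regroup : ∀ A B C D E a b c d e →
    A ℤ.+ B ℤ.+ C ℤ.- D ℤ.- E ℤ.+ (a ℤ.+ b ℤ.+ c ℤ.- d ℤ.- e) ≡
    (A ℤ.+ a) ℤ.+ (B ℤ.+ b) ℤ.+ (C ℤ.+ c) ℤ.- (D ℤ.+ d) ℤ.- (E ℤ.+ e)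
  regroup = solve-∀

sumToℤ-mono-≤ : ∀ n {f g : ℕ → ℤ} → (∀ i → f (suc i) ℤ.≤ g (suc i)) → sumToℤ n f ℤ.≤ sumToℤ n g
sumToℤ-mono-≤ zero    f≤g = ℤP.≤-refl
sumToℤ-mono-≤ (suc n) f≤g = ℤP.+-mono-≤ (sumToℤ-mono-≤ n f≤g) (f≤g n)

sumToℤ-comm : ∀ a b (D : ℕ → ℕ → ℤ) →
  sumToℤ a (λ i → sumToℤ b (λ j → D i j)) ≡ sumToℤ b (λ j → sumToℤ a (λ i → D i j))
sumToℤ-comm zero    b D = sym (sumToℤ-zero b)
sumToℤ-comm (suc a) b D rewrite sumToℤ-comm a b D =
  sym (sumToℤ-+ b (λ j → sumToℤ a (λ i → D i j)) (λ j → D (suc a) j))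

+-sumTo : ∀ n (f : ℕ → ℕ) → + sumTo n f ≡ sumToℤ n (λ i → + f i)
+-sumTo zero    f = refl
+-sumTo (suc n) f = trans (ℤP.pos-+ (sumTo n f) (f (suc n))) (cong (ℤ._+ + f (suc n)) (+-sumTo n f))

alternating : (ℕ → ℤ) → ∀ t → Vec ℕ (suc (t * 2)) → ℤ
alternating δ zero    (x ∷ [])     = + 2 ℤ.* δ x
alternating δ (suc t) (x ∷ y ∷ xs) = δ x ℤ.- δ y ℤ.+ alternating δ t xs

altSum≡alternating : ∀ {m n} (F : Image m n) t xs → altSum F t xs ≡ alternating (dSeq F) t xs
altSum≡alternating F zero    (x ∷ [])     = refl
altSum≡alternating F (suc t) (x ∷ y ∷ xs) = cong (ℤ._+_ (dSeq F x ℤ.- dSeq F y)) (altSum≡alternating F t xs)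

alternating-cong : ∀ {δ δ' : ℕ → ℤ} → (∀ i → δ i ≡ δ' i) →
  ∀ t xs → alternating δ t xs ≡ alternating δ' t xs
alternating-cong δ≗δ' zero    (x ∷ [])     = cong (+ 2 ℤ.*_) (δ≗δ' x)
alternating-cong δ≗δ' (suc t) (x ∷ y ∷ xs) =
  cong₂ ℤ._+_ (cong₂ ℤ._-_ (δ≗δ' x) (δ≗δ' y)) (alternating-cong δ≗δ' t xs)

alternating-sumToℤ : ∀ n (D : ℕ → ℕ → ℤ) t xs →
  alternating (λ i → sumToℤ n (λ j → D j i)) t xs ≡ sumToℤ n (λ j → alternating (D j) t xs)
alternating-sumToℤ n D zero    (x ∷ [])     = sym (sumToℤ-*ˡ n (+ 2) (λ j → D j x))
alternating-sumToℤ n D (suc t) (x ∷ y ∷ xs) = begin-equality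
  sumToℤ n (λ j → D j x) ℤ.- sumToℤ n (λ j → D j y) ℤ.+ alternating (λ i → sumToℤ n (λ j → D j i)) t xs
    ≡⟨ cong₂ ℤ._+_ (sym (sumToℤ-- n (λ j → D j x) (λ j → D j y))) (alternating-sumToℤ n D t xs) ⟩
  sumToℤ n (λ j → D j x ℤ.- D j y) ℤ.+ sumToℤ n (λ j → alternating (D j) t xs)
    ≡⟨ sym (sumToℤ-+ n (λ j → D j x ℤ.- D j y) (λ j → alternating (D j) t xs)) ⟩
  sumToℤ n (λ j → D j x ℤ.- D j y ℤ.+ alternating (D j) t xs) ∎

finalTermAt : ℕ → ∀ {n} → Vec ℕ (suc n) → (ℕ → ℤ) → ℤ
finalTermAt k xs δ = if last xs ≡ᵇ k then + 2 ℤ.* δ k else + 0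

finalTermAt-sumToℤ : ∀ k {l} (xs : Vec ℕ (suc l)) n (D : ℕ → ℕ → ℤ) →
  finalTermAt k xs (λ i → sumToℤ n (λ j → D j i)) ≡ sumToℤ n (λ j → finalTermAt k xs (D j))
finalTermAt-sumToℤ k xs n D with last xs ≡ᵇ k
... | true  = sym (sumToℤ-*ˡ n (+ 2) (λ j → D j k))
... | false = sym (sumToℤ-zero n)

finalTermAt-nonpos : ∀ k {l} (xs : Vec ℕ (suc l)) {δ : ℕ → ℤ} → δ k ℤ.≤ + 0 → finalTermAt k xs δ ℤ.≤ + 0
finalTermAt-nonpos k xs δk≤0 with last xs ≡ᵇ k
... | true  = ℤP.*-monoˡ-≤-nonNeg (+ 2) δk≤0
... | false = ℤP.≤-refl

linked-from-lookup : ∀ {n} (xs : Vec ℕ n) →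
  (∀ a b → a Data.Fin.< b → lookup xs a < lookup xs b) → Linked _<_ xs
linked-from-lookup []           _  = []
linked-from-lookup (x ∷ [])     _  = [-]
linked-from-lookup (x ∷ y ∷ xs) lt =
  lt Data.Fin.zero (Data.Fin.suc Data.Fin.zero) (s≤s z≤n) ∷
  linked-from-lookup (y ∷ xs) (λ a b a<b → lt (Data.Fin.suc a) (Data.Fin.suc b) (s≤s a<b))

All-last : ∀ {n} {P : ℕ → Set} {xs : Vec ℕ (suc n)} → All P xs → P (last xs)
All-last {xs = x ∷ []}     (px ∷ [])  = px
All-last {xs = x ∷ y ∷ xs} (px ∷ pxs) = All-last pxs

All-init : ∀ {n} {P : ℕ → Set} {xs : Vec ℕ (suc n)} → All P xs → All P (init xs)
All-init {xs = x ∷ []}     (px ∷ [])  = []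
All-init {xs = x ∷ y ∷ xs} (px ∷ pxs) = px ∷ All-init pxs

All-init-below : ∀ {n k M} {xs : Vec ℕ (suc n)} → k < M → Linked _<_ xs →
  All (λ x → x ≤ k ⊎ x ≡ M) xs → All (_≤ k) (init xs)
All-init-below {xs = x ∷ []}     k<M _             _                  = []
All-init-below {xs = x ∷ y ∷ xs} k<M (x<y ∷ linked) (x∈ ∷ y∈ ∷ rest) =
  below x∈ y∈ ∷ All-init-below k<M linked (y∈ ∷ rest)
  where
  below : x ≤ _ ⊎ x ≡ _ → y ≤ _ ⊎ y ≡ _ → x ≤ _
  below (inj₁ x≤k)  _           = x≤k
  below (inj₂ refl) (inj₁ y≤k)  = ⊥-elim (ℕP.<-asym k<M (ℕP.<-≤-trans x<y y≤k))
  below (inj₂ refl) (inj₂ refl) = ⊥-elim (ℕP.<-irrefl refl x<y)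

-- Collecting an alternating sum against a potential

data Phase : Set where
  plusNext minusNext closed : Phase

data Move : Phase → Phase → Set where
  stay      : ∀ {φ} → Move φ φ
  takePlus  : Move plusNext minusNext
  takeMinus : Move minusNext plusNext
  takeLast  : Move plusNext closed

coefficient : ∀ {φ ψ} → Move φ ψ → ℤ
coefficient stay      = + 0
coefficient takePlus  = + 1
coefficient takeMinus = -[1+ 0 ]
coefficient takeLast  = + 2

module Walk (δ : ℕ → ℤ) (Ψ : Phase → ℕ → ℤ)
  (advance : ∀ {φ ψ} (μ : Move φ ψ) i → Ψ φ i ℤ.+ coefficient μ ℤ.* δ (suc i) ℤ.≤ Ψ ψ (suc i)) where

  climb : ∀ {φ a i} → a ≤ i → Ψ φ a ℤ.≤ Ψ φ i
  climb a≤i = climb′ (ℕP.≤⇒≤′ a≤i)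
    where
    climb′ : ∀ {φ a i} → a ℕ.≤′ i → Ψ φ a ℤ.≤ Ψ φ i
    climb′         ℕ.≤′-refl          = ℤP.≤-refl
    climb′ {φ} {i = suc i} (ℕ.≤′-step a≤i) = begin
      Ψ φ _             ≤⟨ climb′ a≤i ⟩
      Ψ φ i             ≡⟨ ℤP.+-identityʳ (Ψ φ i) ⟨
      Ψ φ i ℤ.+ + 0     ≤⟨ advance stay i ⟩
      Ψ φ (suc i)       ∎

  moveAt : ∀ {φ ψ} (μ : Move φ ψ) {a x} → a < x → Ψ φ a ℤ.+ coefficient μ ℤ.* δ x ℤ.≤ Ψ ψ x
  moveAt μ {x = suc x} (s≤s a≤x) = ℤP.≤-trans (ℤP.+-monoˡ-≤ _ (climb a≤x)) (advance μ x)

  module WithinBound (b : ℕ) where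

    Finisher : ℕ → ℤ → Set
    Finisher x Z = ∀ {a} → a ≤ b → a < x → Ψ plusNext a ℤ.+ + 2 ℤ.* δ x ℤ.≤ Z

    mutual
      walkPlus : ∀ t (xs : Vec ℕ (suc (t * 2))) {a Z} → a ≤ b → a < head xs → Linked _<_ xs →
        All (_≤ b) (init xs) → Finisher (last xs) Z → Ψ plusNext a ℤ.+ alternating δ t xs ℤ.≤ Z
      walkPlus zero    (x ∷ [])     a≤b a<x _               _            finish = finish a≤b a<x
      walkPlus (suc t) (x ∷ y ∷ xs) {a} {Z} a≤b a<x (x<y ∷ linked) (x≤b ∷ inits) finish = begin
        Ψ plusNext a ℤ.+ (δ x ℤ.- δ y ℤ.+ alternating δ t xs)  ≡⟨ regroup (Ψ plusNext a) (δ x) (δ y) _ ⟩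
        Ψ plusNext a ℤ.+ δ x ℤ.- δ y ℤ.+ alternating δ t xs    ≤⟨ ℤP.+-monoˡ-≤ _ (ℤP.+-monoˡ-≤ _ enter) ⟩
        Ψ minusNext x ℤ.- δ y ℤ.+ alternating δ t xs           ≤⟨ walkMinus t y xs x≤b x<y linked inits finish ⟩
        Z                                                       ∎
        where
        regroup : ∀ p u v w → p ℤ.+ (u ℤ.- v ℤ.+ w) ≡ p ℤ.+ u ℤ.- v ℤ.+ w
        regroup = solve-∀
        enter : Ψ plusNext a ℤ.+ δ x ℤ.≤ Ψ minusNext x
        enter = ℤP.≤-trans (ℤP.≤-reflexive (cong (ℤ._+_ (Ψ plusNext a)) (sym (ℤP.*-identityˡ (δ x)))))
                           (moveAt takePlus a<x)

      walkMinus : ∀ t y (xs : Vec ℕ (suc (t * 2))) {a Z} → a ≤ b → a < y → Linked _<_ (y ∷ xs) →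
        All (_≤ b) (init (y ∷ xs)) → Finisher (last xs) Z →
        Ψ minusNext a ℤ.- δ y ℤ.+ alternating δ t xs ℤ.≤ Z
      walkMinus t y xs {a} a≤b a<y (y<xs ∷ linked) (y≤b ∷ inits) finish =
        ℤP.≤-trans (ℤP.+-monoˡ-≤ _ leave) (walkPlus t xs y≤b y<xs linked inits finish)
        where
        leave : Ψ minusNext a ℤ.- δ y ℤ.≤ Ψ plusNext y
        leave = ℤP.≤-trans (ℤP.≤-reflexive (cong (ℤ._+_ (Ψ minusNext a)) (sym (ℤP.-1*i≡-i (δ y)))))
                           (moveAt takeMinus a<y)

-- One column

-- Row i of a column: (i, j) ∈ F, i ≤ c_j, and P_i > 0.
record Cell : Set where
  constructor cell
  field
    filled inside owing : Bool

open Cell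

cellDefect : Cell → ℤ
cellDefect c = + ind (inside c) ℤ.- + ind (filled c)

crossing : Cell → Cell → ℤ
crossing c c' = + ind (filled c xor filled c')

-- Whether c' can sit directly above c: `inside` never switches back on, and `owing` is
-- the sign of a running total P ≥ 0 that changes by the defect of each new cell.
follows : Cell → Cell → Bool
follows (cell _ g p) (cell h' g' p') = (not g' ∨ g) ∧ owingUpdate
  where
  owingUpdate = if p then h' ∧ not g' ∨ p'
                     else not (h' ∧ not g') ∧ (if g' ∧ not h' then p' else not p')

positive : ℤ → Bool
positive +[1+ _ ] = true
positive _        = false

positive≤ : ∀ {P} → + 0 ℤ.≤ P → + ind (positive P) ℤ.≤ P
positive≤ {+ zero}   _ = ℤP.≤-refl
positive≤ {+[1+ n ]} _ = ℤ.+≤+ (s≤s z≤n)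

follows-running-total : ∀ {h g} h' g' P → (T g' → T g) →
  + 0 ℤ.≤ P → + 0 ℤ.≤ P ℤ.+ (+ ind g' ℤ.- + ind h') →
  T (follows (cell h g (positive P)) (cell h' g' (positive (P ℤ.+ (+ ind g' ℤ.- + ind h')))))
follows-running-total {g = false} _     true  _          g'⇒g _ _  = ⊥-elim (g'⇒g _)
follows-running-total {g = true}  false true  (+ zero)   _    _ _  = _
follows-running-total {g = true}  false true  +[1+ n ]   _    _ _  = _
follows-running-total {g = true}  true  true  (+ zero)   _    _ _  = _
follows-running-total {g = true}  true  true  +[1+ n ]   _    _ _  = _
follows-running-total {g = _}     false false (+ zero)   _    _ _  = _
follows-running-total {g = _}     false false +[1+ n ]   _    _ _  = _
follows-running-total {g = _}     true  false +[1+ n ]   _    _ _  = _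
follows-running-total {g = _}     true  false (+ zero)   _    _ ()
follows-running-total             _     _     -[1+ n ]   _    () _

-- A lower bound for the boundary still to be crossed minus the alternating terms still to be
-- collected; these values are the exact optimum of this finite problem.
potential : Phase → Cell → ℤ
potential closed    (cell true  _ _) = + 1
potential closed    (cell false _ p) = + (2 * ind p)
potential minusNext (cell true  _ p) = + 1 ℤ.- + ind p
potential minusNext (cell false _ p) = + ind p
potential plusNext  (cell true  g p) = + 1 ℤ.- + ind (p ∧ g)
potential plusNext  (cell false g p) = + ind (p ∧ not g)

-- The least value of `potential φ` over all phases φ: what the rows above k pay at least,
-- whatever J is.
handover : Cell → ℤ
handover (cell true  _ p) = + 1 ℤ.- + ind p
handover (cell false g p) = + ind (p ∧ not g)

∀-Bool? : {P : Bool → Set} → (∀ b → Dec (P b)) → Dec (∀ b → P b)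
∀-Bool? P? with P? false | P? true
... | yes pf  | yes pt = yes λ { false → pf ; true → pt }
... | no ¬pf  | _      = no λ all → ¬pf (all false)
... | _       | no ¬pt = no λ all → ¬pt (all true)

∀-Cell? : {P : Cell → Set} → (∀ c → Dec (P c)) → Dec (∀ c → P c)
∀-Cell? P? with ∀-Bool? (λ h → ∀-Bool? λ g → ∀-Bool? λ p → P? (cell h g p))
... | yes all = yes λ c → all (filled c) (inside c) (owing c)
... | no ¬all = no λ all → ¬all λ h g p → all (cell h g p)

by-exhaustion : {P : Cell → Set} (P? : ∀ c → Dec (P c)) {_ : True (∀-Cell? P?)} → ∀ c → P c
by-exhaustion P? {all} = toWitness all

Advances : ∀ {φ ψ} → Move φ ψ → Cell → Cell → Set
Advances {φ} {ψ} μ c c' =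
  T (follows c c') → potential φ c ℤ.+ coefficient μ ℤ.* cellDefect c' ℤ.≤ crossing c c' ℤ.+ potential ψ c'

advances? : ∀ {φ ψ} (μ : Move φ ψ) c → Dec (∀ c' → Advances μ c c')
advances? μ c = ∀-Cell? λ c' → T? (follows c c') →-dec (_ ℤ.≤? _)

potential-advance : ∀ {φ ψ} (μ : Move φ ψ) c c' → Advances μ c c'
potential-advance {plusNext}  stay = by-exhaustion (advances? (stay {plusNext}))
potential-advance {minusNext} stay = by-exhaustion (advances? (stay {minusNext}))
potential-advance {closed}    stay = by-exhaustion (advances? (stay {closed}))
potential-advance takePlus         = by-exhaustion (advances? takePlus)
potential-advance takeMinus        = by-exhaustion (advances? takeMinus)
potential-advance takeLast         = by-exhaustion (advances? takeLast)

handover≤potential : ∀ φ c → handover c ℤ.≤ potential φ c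
handover≤potential plusNext  = by-exhaustion λ c → _ ℤ.≤? _
handover≤potential minusNext = by-exhaustion λ c → _ ℤ.≤? _
handover≤potential closed    = by-exhaustion λ c → _ ℤ.≤? _

potential-plusNext≤handover : ∀ c → potential plusNext c ℤ.≤ + ind (owing c) ℤ.+ handover c
potential-plusNext≤handover = by-exhaustion λ c → _ ℤ.≤? _

potential-closed-handover : ∀ c c' → T (follows c c') →
  potential closed c ℤ.≤
  crossing c c' ℤ.+ ((+ ind (owing c) ℤ.+ cellDefect c') ℤ.⊔ + ind (owing c')) ℤ.+ handover c'
potential-closed-handover = by-exhaustion λ c → ∀-Cell? λ c' → T? (follows c c') →-dec (_ ℤ.≤? _)

module Column (m : ℕ) (f : ℕ → Bool) (f-bottom : f 0 ≡ false) (f-top : ∀ i → m < i → f i ≡ false) where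

  -- Counting row 0 as filled changes the number of crossings by 1 − 2 f₁, absorbing 2 r₁.
  floored : ℕ → Bool
  floored zero    = true
  floored (suc i) = f (suc i)

  height : ℕ
  height = sumTo m (λ i → ind (f i))

  filledBelow : ℕ → ℕ
  filledBelow i = sumTo i (λ l → ind (f l))

  defect : ℕ → ℤ
  defect i = + ind (i ≤ᵇ height) ℤ.- + ind (floored i)

  owed : ℕ → ℤ
  owed i = sumToℤ i defect

  cellAt : ℕ → Cell
  cellAt i = cell (floored i) (i ≤ᵇ height) (positive (owed i))

  flips : ℕ → ℕ
  flips zero    = 0
  flips (suc i) = ind (floored i xor floored (suc i))

  crossings : ℕ → ℤ
  crossings i = + flips i

  height≤m : height ≤ m
  height≤m = sumTo-ind≤ m f

  filledBelow-beyond : ∀ d → filledBelow (d + m) ≡ height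
  filledBelow-beyond zero    = refl
  filledBelow-beyond (suc d) rewrite filledBelow-beyond d | f-top (suc (d + m)) (s≤s (ℕP.m≤n+m m d)) =
    ℕP.+-identityʳ height

  filledBelow≤height : ∀ i → filledBelow i ≤ height
  filledBelow≤height i = ℕP.≤-trans (sumTo-monoʳ _ (ℕP.m≤m+n i m)) (ℕP.≤-reflexive (filledBelow-beyond i))

  insideBelow : ∀ i → sumTo i (λ l → ind (l ≤ᵇ height)) ≡ i ⊓ height
  insideBelow zero    = refl
  insideBelow (suc i) rewrite insideBelow i with ℕP.≤-<-connex (suc i) height
  ... | inj₁ i<h rewrite ≤ᵇ-true i<h | ℕP.m≤n⇒m⊓n≡m i<h | ℕP.m≤n⇒m⊓n≡m (ℕP.<⇒≤ i<h) = ℕP.+-comm i 1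
  ... | inj₂ h≤i rewrite ≤ᵇ-false h≤i | ℕP.m≥n⇒m⊓n≡n (ℕP.≤-pred h≤i) | ℕP.m≥n⇒m⊓n≡n (ℕP.<⇒≤ h≤i) =
    ℕP.+-identityʳ height

  owed-as-difference : ∀ i → owed i ≡ + (i ⊓ height) ℤ.- + filledBelow i
  owed-as-difference i = begin-equality
    owed i                                                                ≡⟨ sumToℤ-- i _ _ ⟩
    sumToℤ i (λ l → + ind (l ≤ᵇ height)) ℤ.- sumToℤ i (λ l → + ind (floored l))
      ≡⟨ cong₂ ℤ._-_ (sym (+-sumTo i _)) (sumToℤ-cong i (λ _ → refl)) ⟩
    + sumTo i (λ l → ind (l ≤ᵇ height)) ℤ.- sumToℤ i (λ l → + ind (f l))
      ≡⟨ cong₂ ℤ._-_ (cong +_ (insideBelow i)) (sym (+-sumTo i _)) ⟩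
    + (i ⊓ height) ℤ.- + filledBelow i                                    ∎

  owed-nonneg : ∀ i → + 0 ℤ.≤ owed i
  owed-nonneg i rewrite owed-as-difference i =
    ℤP.i≤j⇒0≤j-i (ℤ.+≤+ (ℕP.⊓-glb (sumTo-ind≤ i f) (filledBelow≤height i)))

  owed-top : owed (suc m) ≡ + 0
  owed-top rewrite owed-as-difference (suc m) | ℕP.m≥n⇒m⊓n≡n (ℕP.m≤n⇒m≤1+n height≤m) | filledBelow-beyond 1 =
    ℤP.+-inverseʳ (+ height)

  defect-beyond : ∀ i → m < i → defect i ≡ + 0
  defect-beyond (suc i) m<i rewrite ≤ᵇ-false (ℕP.≤-<-trans height≤m m<i) | f-top (suc i) m<i = refl

  cellAt-follows : ∀ i → T (follows (cellAt i) (cellAt (suc i)))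
  cellAt-follows i = follows-running-total {h = floored i} (f (suc i)) (suc i ≤ᵇ height) (owed i)
                       inside-shrinks (owed-nonneg i) (owed-nonneg (suc i))
    where
    inside-shrinks : T (suc i ≤ᵇ height) → T (i ≤ᵇ height)
    inside-shrinks si≤h = ℕP.≤⇒≤ᵇ (ℕP.≤-trans (ℕP.n≤1+n i) (ℕP.≤ᵇ⇒≤ (suc i) height si≤h))

  Ψ : Phase → ℕ → ℤ
  Ψ φ i = sumToℤ i crossings ℤ.+ potential φ (cellAt i)

  advance : ∀ {φ ψ} (μ : Move φ ψ) i → Ψ φ i ℤ.+ coefficient μ ℤ.* defect (suc i) ℤ.≤ Ψ ψ (suc i)
  advance {φ} {ψ} μ i = begin
    sumToℤ i crossings ℤ.+ potential φ (cellAt i) ℤ.+ coefficient μ ℤ.* defect (suc i)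
      ≡⟨ ℤP.+-assoc (sumToℤ i crossings) _ _ ⟩
    sumToℤ i crossings ℤ.+ (potential φ (cellAt i) ℤ.+ coefficient μ ℤ.* defect (suc i))
      ≤⟨ ℤP.+-monoʳ-≤ (sumToℤ i crossings) (potential-advance μ (cellAt i) (cellAt (suc i)) (cellAt-follows i)) ⟩
    sumToℤ i crossings ℤ.+ (crossings (suc i) ℤ.+ potential ψ (cellAt (suc i)))
      ≡⟨ ℤP.+-assoc (sumToℤ i crossings) _ _ ⟨
    Ψ ψ (suc i) ∎

  module W = Walk defect Ψ advance

  owing≤owed : ∀ i → + ind (owing (cellAt i)) ℤ.≤ owed i
  owing≤owed i = positive≤ (owed-nonneg i)

  lowerEnd : ℕ → ℤ
  lowerEnd k = sumToℤ k crossings ℤ.+ owed k ℤ.+ handover (cellAt k)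

  plusNext-lowerEnd : ∀ k → Ψ plusNext k ℤ.≤ lowerEnd k
  plusNext-lowerEnd k = begin
    sumToℤ k crossings ℤ.+ potential plusNext (cellAt k)
      ≤⟨ ℤP.+-monoʳ-≤ (sumToℤ k crossings) (potential-plusNext≤handover (cellAt k)) ⟩
    sumToℤ k crossings ℤ.+ (+ ind (owing (cellAt k)) ℤ.+ handover (cellAt k))
      ≤⟨ ℤP.+-monoʳ-≤ (sumToℤ k crossings) (ℤP.+-monoˡ-≤ (handover (cellAt k)) (owing≤owed k)) ⟩
    sumToℤ k crossings ℤ.+ (owed k ℤ.+ handover (cellAt k))
      ≡⟨ ℤP.+-assoc (sumToℤ k crossings) (owed k) (handover (cellAt k)) ⟨
    lowerEnd k ∎

  closed-lowerEnd : ∀ {a k} → a < k → Ψ closed a ℤ.≤ lowerEnd k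
  closed-lowerEnd {a} {suc k} (s≤s a≤k) = begin
    Ψ closed a
      ≤⟨ W.climb {closed} a≤k ⟩
    S ℤ.+ potential closed (cellAt k)
      ≤⟨ ℤP.+-monoʳ-≤ S (potential-closed-handover (cellAt k) (cellAt (suc k)) (cellAt-follows k)) ⟩
    S ℤ.+ (crossings (suc k) ℤ.+ owedBelow ℤ.+ handover (cellAt (suc k)))
      ≤⟨ ℤP.+-monoʳ-≤ S (ℤP.+-monoˡ-≤ (handover (cellAt (suc k)))
                           (ℤP.+-monoʳ-≤ (crossings (suc k)) owedBelow≤owed)) ⟩
    S ℤ.+ (crossings (suc k) ℤ.+ owed (suc k) ℤ.+ handover (cellAt (suc k)))
      ≡⟨ regroup S _ _ _ ⟩
    lowerEnd (suc k) ∎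
    where
    owedBelow : ℤ
    owedBelow = (+ ind (owing (cellAt k)) ℤ.+ defect (suc k)) ℤ.⊔ + ind (owing (cellAt (suc k)))
    owedBelow≤owed : owedBelow ℤ.≤ owed (suc k)
    owedBelow≤owed = ℤP.⊔-lub (ℤP.+-monoˡ-≤ (defect (suc k)) (owing≤owed k)) (owing≤owed (suc k))
    S : ℤ
    S = sumToℤ k crossings
    regroup : ∀ s c o h → s ℤ.+ (c ℤ.+ o ℤ.+ h) ≡ s ℤ.+ c ℤ.+ o ℤ.+ h
    regroup = solve-∀

  -- A final index k or m + 1 is left pending at row k: δ_{m+1} = 0, and the term at k is the
  -- one set aside in `finalTermAt`.
  lowerFinish : ∀ {k} → k ≤ m → ∀ {n} (I : Vec ℕ (suc n)) → last I ≤ k ⊎ last I ≡ suc m →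
    W.WithinBound.Finisher k (last I) (lowerEnd k ℤ.+ finalTermAt k I defect)
  lowerFinish {k} k≤m I (inj₁ x≤k) {a} a≤k a<x with ℕP.m≤n⇒m<n∨m≡n x≤k
  ... | inj₁ x<k rewrite ≡ᵇ-false (ℕP.<⇒≢ x<k) | ℤP.+-identityʳ (lowerEnd k) =
    ℤP.≤-trans (W.moveAt takeLast a<x) (closed-lowerEnd x<k)
  ... | inj₂ x≡k rewrite ≡ᵇ-true x≡k | x≡k =
    ℤP.+-monoˡ-≤ _ (ℤP.≤-trans (W.climb {plusNext} a≤k) (plusNext-lowerEnd k))
  lowerFinish {k} k≤m I (inj₂ x≡1+m) {a} a≤k a<x
    rewrite ≡ᵇ-false (λ x≡k → ℕP.<⇒≢ (s≤s k≤m) (trans (sym x≡k) x≡1+m))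
          | defect-beyond (last I) (ℕP.≤-reflexive (sym x≡1+m))
          | ℤP.+-identityʳ (Ψ plusNext a) | ℤP.+-identityʳ (lowerEnd k) =
    ℤP.≤-trans (W.climb {plusNext} a≤k) (plusNext-lowerEnd k)

  lowerBound : ∀ {k} → 1 ≤ k → k ≤ m → ∀ t (I : Vec ℕ (suc (t * 2))) → Linked _<_ I →
    All (λ x → x ≤ k ⊎ x ≡ suc m) I →
    + 1 ℤ.+ alternating defect t I ℤ.≤ lowerEnd k ℤ.+ finalTermAt k I defect
  lowerBound {suc k} _ k≤m zero (zero ∷ []) _ _ = begin
    + 1                         ≤⟨ closed-lowerEnd {0} {suc k} (s≤s z≤n) ⟩
    lowerEnd (suc k)            ≡⟨ ℤP.+-identityʳ (lowerEnd (suc k)) ⟨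
    lowerEnd (suc k) ℤ.+ + 0    ∎
  lowerBound {suc k} _ k≤m (suc t) I@(zero ∷ y ∷ xs) linked@(0<y ∷ linked′) range = begin
    + 1 ℤ.+ (+ 0 ℤ.- defect y ℤ.+ alternating defect t xs)  ≡⟨ regroup (defect y) (alternating defect t xs) ⟩
    Ψ minusNext 0 ℤ.- defect y ℤ.+ alternating defect t xs  ≤⟨ W.WithinBound.walkMinus (suc k) t y xs z≤n 0<y linked′
                                                                  (All.tail (All-init-below (s≤s k≤m) linked range))
                                                                  (lowerFinish k≤m I (All-last range)) ⟩
    lowerEnd (suc k) ℤ.+ finalTermAt (suc k) I defect        ∎
    where
    regroup : ∀ u v → + 1 ℤ.+ (+ 0 ℤ.- u ℤ.+ v) ≡ + 1 ℤ.- u ℤ.+ v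
    regroup = solve-∀
  lowerBound {k} _ k≤m t I@(suc _ ∷ _) linked range =
    W.WithinBound.walkPlus k t I z≤n (s≤s z≤n) linked (All-init-below (s≤s k≤m) linked range)
      (lowerFinish k≤m I (All-last range))

  upperEnd : ℤ
  upperEnd = sumToℤ (suc m) crossings

  cellAt-top : cellAt (suc m) ≡ cell false false false
  cellAt-top rewrite owed-top | f-top (suc m) ℕP.≤-refl | ≤ᵇ-false {suc m} {height} (s≤s height≤m) = refl

  closed-top : Ψ closed (suc m) ≡ upperEnd
  closed-top = trans (cong (λ c → upperEnd ℤ.+ potential closed c) cellAt-top) (ℤP.+-identityʳ upperEnd)

  upperFinish : ∀ {n} (J : Vec ℕ (suc n)) → last J ≤ suc m → W.WithinBound.Finisher (suc m) (last J) upperEnd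
  upperFinish J x≤1+m _ a<x =
    ℤP.≤-trans (W.moveAt takeLast a<x) (ℤP.≤-trans (W.climb {closed} x≤1+m) (ℤP.≤-reflexive closed-top))

  handover≤Ψ : ∀ k φ → sumToℤ k crossings ℤ.+ handover (cellAt k) ℤ.≤ Ψ φ k
  handover≤Ψ k φ = ℤP.+-monoʳ-≤ (sumToℤ k crossings) (handover≤potential φ (cellAt k))

  upperIndex≤ : ∀ {k x} → x ≡ 0 ⊎ (suc k ≤ x × x ≤ suc m) → x ≤ suc m
  upperIndex≤ (inj₁ refl)        = z≤n
  upperIndex≤ (inj₂ (_ , x≤1+m)) = x≤1+m

  upperIndex> : ∀ {k x} → 0 < x → x ≡ 0 ⊎ (suc k ≤ x × x ≤ suc m) → k < x
  upperIndex> 0<x (inj₁ refl)      = ⊥-elim (ℕP.<-irrefl refl 0<x)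
  upperIndex> _   (inj₂ (k<x , _)) = k<x

  upperBound : ∀ {k} → k ≤ m → ∀ s (J : Vec ℕ (suc (s * 2))) → Linked _<_ J →
    All (λ x → x ≡ 0 ⊎ (suc k ≤ x × x ≤ suc m)) J →
    sumToℤ k crossings ℤ.+ handover (cellAt k) ℤ.+ alternating defect s J ℤ.≤ upperEnd
  upperBound {k} k≤m zero (zero ∷ []) _ _ = begin
    sumToℤ k crossings ℤ.+ handover (cellAt k) ℤ.+ + 0  ≡⟨ ℤP.+-identityʳ _ ⟩
    sumToℤ k crossings ℤ.+ handover (cellAt k)          ≤⟨ handover≤Ψ k closed ⟩
    Ψ closed k                                          ≤⟨ W.climb {closed} (ℕP.m≤n⇒m≤1+n k≤m) ⟩
    Ψ closed (suc m)                                    ≡⟨ closed-top ⟩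
    upperEnd                                            ∎
  upperBound {k} k≤m (suc s) J@(zero ∷ y ∷ xs) (0<y ∷ linked) range@(_ ∷ y∈ ∷ _) = begin
    S ℤ.+ (+ 0 ℤ.- defect y ℤ.+ alternating defect s xs)    ≡⟨ regroup S (defect y) _ ⟩
    S ℤ.- defect y ℤ.+ alternating defect s xs              ≤⟨ ℤP.+-monoˡ-≤ _ (ℤP.+-monoˡ-≤ _ (handover≤Ψ k minusNext)) ⟩
    Ψ minusNext k ℤ.- defect y ℤ.+ alternating defect s xs  ≤⟨ W.WithinBound.walkMinus (suc m) s y xs (ℕP.m≤n⇒m≤1+n k≤m)
                                                                  (upperIndex> 0<y y∈) linked
                                                                  (All-init (All.tail (All.map upperIndex≤ range)))
                                                                  (upperFinish J (upperIndex≤ (All-last range))) ⟩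
    upperEnd                                                ∎
    where
    S : ℤ
    S = sumToℤ k crossings ℤ.+ handover (cellAt k)
    regroup : ∀ a u v → a ℤ.+ (+ 0 ℤ.- u ℤ.+ v) ≡ a ℤ.- u ℤ.+ v
    regroup = solve-∀
  upperBound {k} k≤m s J@(suc _ ∷ _) linked range@(x∈ ∷ _) = ℤP.≤-trans
    (ℤP.+-monoˡ-≤ _ (handover≤Ψ k plusNext))
    (W.WithinBound.walkPlus (suc m) s J (ℕP.m≤n⇒m≤1+n k≤m) (upperIndex> (s≤s z≤n) x∈) linked
      (All-init (All.map upperIndex≤ range)) (upperFinish J (upperIndex≤ (All-last range))))

  columnBound : ∀ {k} → 1 ≤ k → k ≤ m →
    ∀ t (I : Vec ℕ (suc (t * 2))) → Linked _<_ I → All (λ x → x ≤ k ⊎ x ≡ suc m) I →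
    ∀ s (J : Vec ℕ (suc (s * 2))) → Linked _<_ J → All (λ x → x ≡ 0 ⊎ (suc k ≤ x × x ≤ suc m)) J →
    + 1 ℤ.+ alternating defect t I ℤ.+ alternating defect s J ℤ.≤ upperEnd ℤ.+ owed k ℤ.+ finalTermAt k I defect
  columnBound {k} 1≤k k≤m t I linkedI rangeI s J linkedJ rangeJ = begin
    + 1 ℤ.+ alternating defect t I ℤ.+ B
      ≤⟨ ℤP.+-monoˡ-≤ B (lowerBound 1≤k k≤m t I linkedI rangeI) ⟩
    sumToℤ k crossings ℤ.+ owed k ℤ.+ handover (cellAt k) ℤ.+ corr ℤ.+ B
      ≡⟨ regroup (sumToℤ k crossings) (owed k) (handover (cellAt k)) corr B ⟩
    sumToℤ k crossings ℤ.+ handover (cellAt k) ℤ.+ B ℤ.+ owed k ℤ.+ corr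
      ≤⟨ ℤP.+-monoˡ-≤ corr (ℤP.+-monoˡ-≤ (owed k) (upperBound k≤m s J linkedJ rangeJ)) ⟩
    upperEnd ℤ.+ owed k ℤ.+ corr ∎
    where
    B corr : ℤ
    B = alternating defect s J
    corr = finalTermAt k I defect
    regroup : ∀ c o h x b → c ℤ.+ o ℤ.+ h ℤ.+ x ℤ.+ b ≡ c ℤ.+ h ℤ.+ b ℤ.+ o ℤ.+ x
    regroup = solve-∀

  leaving entering : ℕ → ℕ
  leaving  i = ind (f i ∧ not (f (suc i)))
  entering i = ind (f i ∧ not (f (i ∸ 1)))

  boundaryCount : ℕ
  boundaryCount = sumTo m (λ i → leaving i + entering i)

  flips-boundary : sumTo (suc m) flips + 2 * ind (f 1) ≡ boundaryCount + 1
  flips-boundary = trans (cong (_+ 2 * ind (f 1)) flips-sum)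
    (trans (first-row (f 1) (sumTo m leaving) (sumTo m (λ i → entering (suc i))))
           (cong (_+ 1) (trans (cong (_+_ (sumTo m leaving)) entering-shift) (sym (sumTo-+ m leaving entering)))))
    where
    xor-split : ∀ a b → ind (a xor b) ≡ ind (a ∧ not b) + ind (b ∧ not a)
    xor-split false false = refl
    xor-split false true  = refl
    xor-split true  false = refl
    xor-split true  true  = refl
    flips-sum : sumTo (suc m) flips ≡ ind (true xor f 1) + (sumTo m leaving + sumTo m (λ i → entering (suc i)))
    flips-sum = trans (sumTo-unfoldˡ m flips) (cong (_+_ (ind (true xor f 1)))
      (trans (sumTo-cong m (λ i → xor-split (f (suc i)) (f (suc (suc i))))) (sumTo-+ m leaving (λ i → entering (suc i)))))
    entering-shift : ind (f 1 ∧ true) + sumTo m (λ i → entering (suc i)) ≡ sumTo m entering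
    entering-shift = trans (cong (λ b → ind (f 1 ∧ not b) + sumTo m (λ i → entering (suc i))) (sym f-bottom))
      (trans (sym (sumTo-unfoldˡ m entering))
      (trans (cong (λ b → sumTo m entering + ind (b ∧ not (f m))) (f-top (suc m) ℕP.≤-refl)) (ℕP.+-identityʳ _)))
    first-row : ∀ b L E → ind (true xor b) + (L + E) + 2 * ind b ≡ L + (ind (b ∧ true) + E) + 1
    first-row false = ℕ-solve-∀
    first-row true  = ℕ-solve-∀

  crossings-boundary : upperEnd ℤ.+ + 2 ℤ.* + ind (f 1) ≡ + boundaryCount ℤ.+ + 1
  crossings-boundary = begin-equality
    upperEnd ℤ.+ + 2 ℤ.* + ind (f 1)
      ≡⟨ cong₂ ℤ._+_ (sym (+-sumTo (suc m) flips)) (sym (ℤP.pos-* 2 (ind (f 1)))) ⟩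
    + sumTo (suc m) flips ℤ.+ + (2 * ind (f 1))     ≡⟨ sym (ℤP.pos-+ (sumTo (suc m) flips) _) ⟩
    + (sumTo (suc m) flips + 2 * ind (f 1))         ≡⟨ cong +_ flips-boundary ⟩
    + (boundaryCount + 1)                           ≡⟨ ℤP.pos-+ boundaryCount 1 ⟩
    + boundaryCount ℤ.+ + 1                         ∎

  columnInequality : ∀ {k} → 1 ≤ k → k ≤ m →
    ∀ t (I : Vec ℕ (suc (t * 2))) → Linked _<_ I → All (λ x → x ≤ k ⊎ x ≡ suc m) I →
    ∀ s (J : Vec ℕ (suc (s * 2))) → Linked _<_ J → All (λ x → x ≡ 0 ⊎ (suc k ≤ x × x ≤ suc m)) J →
    + 2 ℤ.* + ind (f 1) ℤ.+ alternating defect t I ℤ.+ alternating defect s J ℤ.- owed k ℤ.- finalTermAt k I defect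
      ℤ.≤ + boundaryCount
  columnInequality {k} 1≤k k≤m t I linkedI rangeI s J linkedJ rangeJ = begin
    a ℤ.+ A ℤ.+ B ℤ.- o ℤ.- c                        ≡⟨ split a A B o c ⟩
    + 1 ℤ.+ A ℤ.+ B ℤ.+ (a ℤ.- o ℤ.- c ℤ.- + 1)       ≤⟨ ℤP.+-monoˡ-≤ _ (columnBound 1≤k k≤m t I linkedI rangeI s J linkedJ rangeJ) ⟩
    upperEnd ℤ.+ o ℤ.+ c ℤ.+ (a ℤ.- o ℤ.- c ℤ.- + 1)  ≡⟨ merge upperEnd a o c ⟩
    upperEnd ℤ.+ a ℤ.- + 1                           ≡⟨ cong (ℤ._- + 1) crossings-boundary ⟩
    + boundaryCount ℤ.+ + 1 ℤ.- + 1                  ≡⟨ cancel (+ boundaryCount) ⟩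
    + boundaryCount                                  ∎
    where
    a A B o c : ℤ
    a = + 2 ℤ.* + ind (f 1)
    A = alternating defect t I
    B = alternating defect s J
    o = owed k
    c = finalTermAt k I defect
    split : ∀ a A B o c → a ℤ.+ A ℤ.+ B ℤ.- o ℤ.- c ≡ + 1 ℤ.+ A ℤ.+ B ℤ.+ (a ℤ.- o ℤ.- c ℤ.- + 1)
    split = solve-∀
    merge : ∀ u a o c → u ℤ.+ o ℤ.+ c ℤ.+ (a ℤ.- o ℤ.- c ℤ.- + 1) ≡ u ℤ.+ a ℤ.- + 1
    merge = solve-∀
    cancel : ∀ h → h ℤ.+ + 1 ℤ.- + 1 ≡ h
    cancel = solve-∀

-- The whole image

module Columns {m n} (F : Image m n) where

  column : ℕ → ℕ → Bool
  column j i = mem F i j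

  column-top : ∀ j i → m < i → column j i ≡ false
  column-top zero    (suc i) _     = refl
  column-top (suc j) (suc i) m<1+i with i ℕ.<? m | j ℕ.<? n
  ... | yes i<m | _ = ⊥-elim (ℕP.<⇒≱ i<m (ℕP.≤-pred m<1+i))
  ... | no _    | _ = refl

  module C (j : ℕ) = Column m (column j) refl (column-top j)

  dSeq≡ : ∀ i → dSeq F i ≡ sumToℤ n (λ j → C.defect j i)
  dSeq≡ zero = sym (sumToℤ-zero n)
  dSeq≡ (suc i) with suc i ≤ᵇ m in eq
  ... | true  = trans (cong₂ ℤ._-_ (+-sumTo n _) (+-sumTo n _)) (sym (sumToℤ-- n _ _))
  ... | false = sym (trans (sumToℤ-cong n (λ j → C.defect-beyond (suc j) (suc i) m<1+i)) (sumToℤ-zero n))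
    where
    true≢false : true ≢ false
    true≢false ()
    m<1+i : m < suc i
    m<1+i = ℕP.≰⇒> λ 1+i≤m → true≢false (trans (sym (≤ᵇ-true 1+i≤m)) eq)

  altSum≡ : ∀ t xs → altSum F t xs ≡ sumToℤ n (λ j → alternating (C.defect j) t xs)
  altSum≡ t xs = trans (altSum≡alternating F t xs)
    (trans (alternating-cong dSeq≡ t xs) (alternating-sumToℤ n (λ j i → C.defect j i) t xs))

  sigma≡ : ∀ k → sigma F k ≡ sumToℤ n (λ j → C.owed j k)
  sigma≡ k = trans (sumToℤ-cong k (λ i → dSeq≡ (suc i))) (sumToℤ-comm k n (λ i j → C.defect j i))

  finalTermAt≡ : ∀ k {l} (xs : Vec ℕ (suc l)) →
    finalTermAt k xs (dSeq F) ≡ sumToℤ n (λ j → finalTermAt k xs (C.defect j))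
  finalTermAt≡ k xs = trans (cong (if last xs ≡ᵇ k then_else + 0) (cong (+ 2 ℤ.*_) (dSeq≡ k)))
    (finalTermAt-sumToℤ k xs n (λ j i → C.defect j i))

  firstRow≡ : + 2 ℤ.* + rowSum F 1 ≡ sumToℤ n (λ j → + 2 ℤ.* + ind (column j 1))
  firstRow≡ = trans (cong (+ 2 ℤ.*_) (+-sumTo n _)) (sym (sumToℤ-*ˡ n (+ 2) _))

  horizBoundary≡ : + horizBoundary F ≡ sumToℤ n (λ j → + C.boundaryCount j)
  horizBoundary≡ = +-sumTo n _

  columns≡ : ∀ k t I s J →
    + 2 ℤ.* + rowSum F 1 ℤ.+ altSum F t I ℤ.+ altSum F s J ℤ.- sigma F k ℤ.- finalTermAt k I (dSeq F) ≡
    sumToℤ n (λ j → + 2 ℤ.* + ind (column j 1) ℤ.+ alternating (C.defect j) t I ℤ.+ alternating (C.defect j) s J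
                      ℤ.- C.owed j k ℤ.- finalTermAt k I (C.defect j))
  columns≡ k t I s J rewrite firstRow≡ | altSum≡ t I | altSum≡ s J | sigma≡ k | finalTermAt≡ k I =
    sym (sumToℤ-linear n _ _ _ _ _)

corollary5p3 : (m n : ℕ) → 1 ≤ m → 1 ≤ n → (F : Image m n) →
    (k : ℕ) → 1 ≤ k → k ≤ m →
    dSeq F k ℤ.< + 0 → + 0 ℤ.≤ dSeq F (suc k) →
    (t s : ℕ) →
    (I : Vec ℕ (suc (t * 2))) →
    (∀ (a b : Fin (suc (t * 2))) → a Data.Fin.< b → lookup I a < lookup I b) →
    (∀ (a : Fin (suc (t * 2))) → lookup I a ≤ k ⊎ lookup I a ≡ m + 1) →
    (J : Vec ℕ (suc (s * 2))) →
    (∀ (a b : Fin (suc (s * 2))) → a Data.Fin.< b → lookup J a < lookup J b) →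
    (∀ (a : Fin (suc (s * 2))) → lookup J a ≡ 0 ⊎ (suc k ≤ lookup J a × lookup J a ≤ m + 1)) →
    + horizBoundary F ℤ.≥
      + 2 ℤ.* + rowSum F 1 ℤ.+ altSum F t I ℤ.+ altSum F s J ℤ.- sigma F k
corollary5p3 m n _ _ F k 1≤k k≤m dk<0 _ t s I I-increasing I-range J J-increasing J-range = begin
  RHS                                    ≡⟨ ℤP.+-identityʳ RHS ⟨
  RHS ℤ.+ + 0                            ≤⟨ ℤP.+-monoʳ-≤ RHS (ℤP.neg-mono-≤ (finalTermAt-nonpos k I {dSeq F} (ℤP.<⇒≤ dk<0))) ⟩
  RHS ℤ.- finalTermAt k I (dSeq F)       ≡⟨ columns≡ k t I s J ⟩
  sumToℤ n _                             ≤⟨ sumToℤ-mono-≤ n (λ j →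
                                              C.columnInequality (suc j) 1≤k k≤m t I linkedI rangeI s J linkedJ rangeJ) ⟩
  sumToℤ n (λ j → + C.boundaryCount j)   ≡⟨ horizBoundary≡ ⟨
  + horizBoundary F                      ∎
  where
  open Columns F
  RHS : ℤ
  RHS = + 2 ℤ.* + rowSum F 1 ℤ.+ altSum F t I ℤ.+ altSum F s J ℤ.- sigma F k
  m+1≡1+m : m + 1 ≡ suc m
  m+1≡1+m = ℕP.+-comm m 1
  linkedI : Linked _<_ I
  linkedI = linked-from-lookup I I-increasing
  linkedJ : Linked _<_ J
  linkedJ = linked-from-lookup J J-increasing
  rangeI : All (λ x → x ≤ k ⊎ x ≡ suc m) I
  rangeI = lookup⁻ λ a → Data.Sum.map₂ (λ x≡ → trans x≡ m+1≡1+m) (I-range a)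
  rangeJ : All (λ x → x ≡ 0 ⊎ (suc k ≤ x × x ≤ suc m)) J
  rangeJ = lookup⁻ λ a → Data.Sum.map₂ (Data.Product.map₂ (subst (lookup J a ≤_) m+1≡1+m)) (J-range a)
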